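{- Let $n\ge 1$ and let $f,g:2^{[n]}\to\mathbb N$ be monotone (decreasing) functions with $|f|\le|g|$. Then there is a function $p:2^{[n]}\times 2^{[n]}\to\mathbb N$ such that (i) $p(X,Y)\ne 0$ only if $X,Y\subset[n]$ are disjoint; (ii) $|p|=|f|$; (iii) $\sum_{X\subset[n]}p(X,Y)\le g(Y)$ for every $Y\subset[n]$ and $\sum_{Y\subset[n]}p(X,Y)=f(X)$ for every $X\subset[n]$.
   Context: Here $\mathbb N=\{0,1,2,\dots\}$. A function $f:2^{[n]}\to\mathbb N$ is monotone (decreasing) if $f(A)\le f(A\setminus\{i\})$ for every $A\subset[n]$ and every element $i$. For $f:2^{[n]}\to\mathbb N$, $|f|=\sum_{X\subset[n]}f(X)$; for $p:2^{[n]}\times2^{[n]}\to\mathbb N$, $|p|=\sum_{X,Y\subset[n]}p(X,Y)$. -}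

module Defs where

open import Data.Nat using (ℕ; zero; suc; _≤_; _+_)
open import Data.List using (List; []; _∷_; map; _++_)
open import Data.Nat.ListAction using (sum)
open import Data.Vec using (_∷_; [])
open import Data.Fin using (Fin)
open import Data.Fin.Subset using (Subset; inside; outside; _-_; _∩_; ⊥)
open import Data.Product using (_×_)
open import Relation.Binary.PropositionalEquality using (_≡_)

allSubsets : (n : ℕ) → List (Subset n)
allSubsets zero = [] ∷ []
allSubsets (suc n) = map (outside ∷_) (allSubsets n) ++ map (inside ∷_) (allSubsets n)

Σ⊆ : (n : ℕ) → (Subset n → ℕ) → ℕ
Σ⊆ n h = sum (map h (allSubsets n))

∣_∣ₛ : {n : ℕ} → (Subset n → ℕ) → ℕ
∣_∣ₛ {n} f = Σ⊆ n f

∣_∣₂ : {n : ℕ} → (Subset n → Subset n → ℕ) → ℕ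
∣_∣₂ {n} p = Σ⊆ n (λ X → Σ⊆ n (λ Y → p X Y))

Monotone : {n : ℕ} → (Subset n → ℕ) → Set
Monotone {n} f = (A : Subset n) (i : Fin n) → f A ≤ f (A - i)

Disjoint : {n : ℕ} → Subset n → Subset n → Set
Disjoint X Y = X ∩ Y ≡ ⊥

{-# OPTIONS --safe #-}
-- The supply–demand form of Hall's theorem gives a plan p, supported on disjoint pairs, with row
-- sums f and column sums at most g, as soon as every family 𝒮 of subsets of [n] satisfies
-- Σ_{X ∈ 𝒮} f X ≤ Σ_{Y ∈ N 𝒮} g Y, where N 𝒮 is the family of sets disjoint from some member of 𝒮.
-- The family N 𝒮 is a down-set containing the complement of every member of 𝒮, so Harris's
-- correlation inequality, once for f against the up-set {X ∣ ∁ X ∈ N 𝒮} and once for g against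
-- N 𝒮, gives 2ⁿ Σ_{𝒮} f ≤ |N 𝒮| |f| ≤ |N 𝒮| |g| ≤ 2ⁿ Σ_{N 𝒮} g.
--
-- Hall's theorem is proved by induction on the total supply: a unit of supply at x is sent along
-- an edge x → y after which Hall's condition still holds. If there is no such edge, each candidate
-- y lies in the neighbourhood of a family avoiding x on which Hall's condition is tight; tight
-- families are closed under union, and adding x to their union violates Hall's condition.
module Submission where

open import Data.Bool using (Bool; true; false; T; _∧_; _∨_; if_then_else_)
open import Data.Bool.ListAction using (any; or)
open import Data.Bool.Properties using (T-∧; T-∨; ∨-identityʳ) renaming (_≟_ to _≟ᵇ_)
open import Data.Empty using (⊥-elim)
open import Data.Fin using (zero; suc)
open import Data.Fin.Subset using (Subset; inside; outside; ∁; _⊆_; _∩_; ⊥) renaming (_∈_ to _∈ₛ_)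
open import Data.Fin.Subset.Properties using (∩-inverseʳ; ⊆-antisym; ⊥⊆; x∈p∩q⁺; x∈p∩q⁻; p─q⊆p; p─⊥≡p)
open import Data.List using (List; []; _∷_; map; _++_; cartesianProductWith)
open import Data.List.Membership.Propositional using (_∈_; _∉_; lose)
open import Data.List.Membership.Propositional.Properties using (∈-cartesianProductWith⁺; ∈-++⁺ˡ; ∈-++⁺ʳ; ∈-map⁺; ∈-map⁻)
open import Data.List.Properties using (map-++; map-cong; map-∘)
open import Data.List.Relation.Unary.All using ([])
open import Data.List.Relation.Unary.All.Properties using (All¬⇒¬Any)
open import Data.List.Relation.Unary.AllPairs using ([]; _∷_)
open import Data.List.Relation.Unary.Any using (here; there; satisfied; any?)
open import Data.List.Relation.Unary.Any.Properties using (any⁺; any⁻)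
open import Data.List.Relation.Unary.Unique.Propositional using (Unique)
open import Data.List.Relation.Unary.Unique.Propositional.Properties using (map⁺; ++⁺)
open import Data.Nat using (ℕ; zero; suc; _+_; _*_; _∸_; _^_; _≤_; _≥_; _<_; z≤n; z<s; _<?_)
open import Data.Nat.ListAction using (sum)
open import Data.Nat.ListAction.Properties using (sum-++)
open import Data.Nat.Properties
open import Algebra.Properties.CommutativeSemigroup +-commutativeSemigroup using (interchange)
open import Data.Nat.Tactic.RingSolver using (solve-∀)
open import Data.Product using (Σ; ∃; _×_; _,_; proj₁; proj₂)
open import Data.Sum using (_⊎_; inj₁; inj₂; [_,_])
open import Data.Vec using (_∷_; [])
open import Data.Vec.Properties using (≡-dec; ∷-injectiveʳ)
open import Function using (_∘_; id; Equivalence)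
open import Relation.Binary.Definitions using (Decidable; DecidableEquality)
open import Relation.Binary.PropositionalEquality
  using (_≡_; _≢_; refl; sym; trans; cong; cong₂; subst; subst₂; module ≡-Reasoning)
open import Relation.Nullary using (¬_; yes; no; _×-dec_)
open import Relation.Nullary.Decidable using (⌊_⌋; toWitness; fromWitness)

open import Defs

open Equivalence using (to; from)

∑ : {A : Set} → List A → (A → ℕ) → ℕ
∑ l h = sum (map h l)

module _ {A : Set} where

  ∑-cong : (l : List A) {a b : A → ℕ} → (∀ z → a z ≡ b z) → ∑ l a ≡ ∑ l b
  ∑-cong l a≗b = cong sum (map-cong a≗b l)

  ∑-mono : (l : List A) {a b : A → ℕ} → (∀ z → a z ≤ b z) → ∑ l a ≤ ∑ l b
  ∑-mono []      a≤b = z≤n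
  ∑-mono (z ∷ l) a≤b = +-mono-≤ (a≤b z) (∑-mono l a≤b)

  ∑-zero : (l : List A) → ∑ l (λ _ → 0) ≡ 0
  ∑-zero []      = refl
  ∑-zero (_ ∷ l) = ∑-zero l

  ∑-distrib-+ : (l : List A) (a b : A → ℕ) → ∑ l (λ z → a z + b z) ≡ ∑ l a + ∑ l b
  ∑-distrib-+ []      a b = refl
  ∑-distrib-+ (z ∷ l) a b =
    trans (cong (a z + b z +_) (∑-distrib-+ l a b)) (interchange (a z) (b z) (∑ l a) (∑ l b))

  *-distribˡ-∑ : (l : List A) (k : ℕ) (a : A → ℕ) → k * ∑ l a ≡ ∑ l (λ z → k * a z)
  *-distribˡ-∑ []      k a = *-zeroʳ k
  *-distribˡ-∑ (z ∷ l) k a = trans (*-distribˡ-+ k (a z) (∑ l a)) (cong (k * a z +_) (*-distribˡ-∑ l k a))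

  ∑-++ : (l l′ : List A) (h : A → ℕ) → ∑ (l ++ l′) h ≡ ∑ l h + ∑ l′ h
  ∑-++ l l′ h = trans (cong sum (map-++ h l l′)) (sum-++ (map h l) (map h l′))

𝟙 : Bool → ℕ
𝟙 true  = 1
𝟙 false = 0

𝟙-mono : ∀ {a b} → (T a → T b) → 𝟙 a ≤ 𝟙 b
𝟙-mono {false}         _   = z≤n
𝟙-mono {true}  {true}  _   = ≤-refl
𝟙-mono {true}  {false} a⇒b = ⊥-elim (a⇒b _)

𝟙*-mono : ∀ {a b} k → (T a → T b) → 𝟙 a * k ≤ 𝟙 b * k
𝟙*-mono k a⇒b = *-monoˡ-≤ k (𝟙-mono a⇒b)

𝟙*-mono′ : ∀ {a b} k → (0 < k → T a → T b) → 𝟙 a * k ≤ 𝟙 b * k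
𝟙*-mono′ {a} {b} zero    _   = ≤-reflexive (trans (*-zeroʳ (𝟙 a)) (sym (*-zeroʳ (𝟙 b))))
𝟙*-mono′         (suc k) a⇒b = 𝟙*-mono (suc k) (a⇒b z<s)

𝟙-∨-∧ : ∀ a b k → 𝟙 (a ∨ b) * k + 𝟙 (a ∧ b) * k ≡ 𝟙 a * k + 𝟙 b * k
𝟙-∨-∧ true  b k = refl
𝟙-∨-∧ false b k = +-identityʳ (𝟙 b * k)

𝟙-submodular : ∀ {a b u i} k → (T u → T a ⊎ T b) → (T i → T a × T b) →
               𝟙 u * k + 𝟙 i * k ≤ 𝟙 a * k + 𝟙 b * k
𝟙-submodular {true} {u = u} k u⇒a∨b i⇒a∧b = +-mono-≤ (𝟙*-mono {u} {true} k _) (𝟙*-mono k (proj₂ ∘ i⇒a∧b))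
𝟙-submodular {false} {b} {u} {i} k u⇒a∨b i⇒a∧b =
  subst (𝟙 u * k + 𝟙 i * k ≤_) (+-identityʳ (𝟙 b * k)) (+-mono-≤ (𝟙*-mono k u⇒b) (𝟙*-mono k (proj₁ ∘ i⇒a∧b)))
  where
  u⇒b : _ → T b
  u⇒b tu = [ (λ ()) , id ] (u⇒a∨b tu)

one-unit-gap : ∀ {m n} a b → m + 𝟙 a ≤ n + 𝟙 b → n < m → ¬ T a × T b × n + 𝟙 b ≤ m + 𝟙 a
one-unit-gap {m} {n} true  b     le n<m =
  ⊥-elim (<⇒≱ n<m (+-cancelʳ-≤ 1 m n (≤-trans le (+-monoʳ-≤ n (𝟙-mono {b} _)))))
one-unit-gap {m} {n} false false le n<m = ⊥-elim (<⇒≱ n<m (subst₂ _≤_ (+-identityʳ m) (+-identityʳ n) le))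
one-unit-gap {m} {n} false true  _  n<m = (λ ()) , _ , subst₂ _≤_ (+-comm 1 n) (sym (+-identityʳ m)) n<m

-- The supply–demand theorem

module Transportation {V : Set} (_≟_ : DecidableEquality V)
                      (L : List V) (complete : ∀ v → v ∈ L) (unique : Unique L)
                      (E : V → V → Set) (E? : Decidable E) where

  δ : V → V → ℕ
  δ x z = 𝟙 ⌊ x ≟ z ⌋

  δ-refl : ∀ x → δ x x ≡ 1
  δ-refl x with x ≟ x
  ... | yes _   = refl
  ... | no x≢x = ⊥-elim (x≢x refl)

  δ-≢ : ∀ {x z} → x ≢ z → δ x z ≡ 0
  δ-≢ {x} {z} x≢z with x ≟ z
  ... | yes x≡z = ⊥-elim (x≢z x≡z)
  ... | no _    = refl

  ∑-δ-∉ : ∀ {x} l → x ∉ l → ∑ l (δ x) ≡ 0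
  ∑-δ-∉ []      _   = refl
  ∑-δ-∉ (z ∷ l) x∉ = cong₂ _+_ (δ-≢ (x∉ ∘ here)) (∑-δ-∉ l (x∉ ∘ there))

  ∑-δ-unique : ∀ {x l} → Unique l → x ∈ l → ∑ l (δ x) ≡ 1
  ∑-δ-unique {x} (x≢l ∷ _) (here refl) = cong₂ _+_ (δ-refl x) (∑-δ-∉ _ (All¬⇒¬Any x≢l))
  ∑-δ-unique {x} (z≢l ∷ u) (there x∈l) = cong₂ _+_ (δ-≢ x≢z) (∑-δ-unique u x∈l)
    where
    x≢z : x ≢ _
    x≢z refl = All¬⇒¬Any z≢l x∈l

  ∑-sift : ∀ x (h : V → ℕ) → ∑ L (λ z → h z * δ x z) ≡ h x
  ∑-sift x h = begin
    ∑ L (λ z → h z * δ x z) ≡⟨ ∑-cong L sift ⟩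
    ∑ L (λ z → h x * δ x z) ≡⟨ *-distribˡ-∑ L (h x) (δ x) ⟨
    h x * ∑ L (δ x)         ≡⟨ cong (h x *_) (∑-δ-unique unique (complete x)) ⟩
    h x * 1                 ≡⟨ *-identityʳ (h x) ⟩
    h x                     ∎
    where
    open ≡-Reasoning
    sift : ∀ z → h z * δ x z ≡ h x * δ x z
    sift z with x ≟ z
    ... | yes refl = refl
    ... | no _     = trans (*-zeroʳ (h z)) (sym (*-zeroʳ (h x)))

  decrement : (V → ℕ) → V → V → ℕ
  decrement s x z = s z ∸ δ x z

  decrement-+δ : ∀ s {x} → 0 < s x → ∀ z → s z ≡ decrement s x z + δ x z
  decrement-+δ s {x} sx>0 z with x ≟ z
  ... | yes refl = sym (m∸n+n≡m sx>0)
  ... | no _     = sym (+-identityʳ (s z))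

  ∑-decrement : ∀ s {x} → 0 < s x → ∑ L s ≡ suc (∑ L (decrement s x))
  ∑-decrement s {x} sx>0 = begin
    ∑ L s                                    ≡⟨ ∑-cong L (decrement-+δ s sx>0) ⟩
    ∑ L (λ z → decrement s x z + δ x z)      ≡⟨ ∑-distrib-+ L _ _ ⟩
    ∑ L (decrement s x) + ∑ L (δ x)          ≡⟨ cong (∑ L (decrement s x) +_) (∑-δ-unique unique (complete x)) ⟩
    ∑ L (decrement s x) + 1                  ≡⟨ +-comm _ 1 ⟩
    suc (∑ L (decrement s x))                ∎
    where open ≡-Reasoning

  Family : Set
  Family = V → Bool

  ∅ : Family
  ∅ _ = false

  N : Family → Family
  N S y = any (λ z → S z ∧ ⌊ E? z y ⌋) L

  N-intro : ∀ {S z y} → T (S z) → E z y → T (N S y)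
  N-intro {z = z} Sz Ezy = any⁺ _ (lose (complete z) (from T-∧ (Sz , fromWitness Ezy)))

  N-elim : ∀ {S y} → T (N S y) → ∃ λ z → T (S z) × E z y
  N-elim {S} {y} NSy with satisfied (any⁻ _ L NSy)
  ... | z , Sz∧Ezy = z , proj₁ (to (T-∧ {S z}) Sz∧Ezy) , toWitness (proj₂ (to (T-∧ {S z}) Sz∧Ezy))

  N-mono : ∀ {S S′ y} → (∀ {z} → T (S z) → T (S′ z)) → T (N S y) → T (N S′ y)
  N-mono S⊆S′ NSy with N-elim NSy
  ... | z , Sz , Ezy = N-intro (S⊆S′ Sz) Ezy

  N-∪ : ∀ {S S′ y} → T (N (λ z → S z ∨ S′ z) y) → T (N S y) ⊎ T (N S′ y)
  N-∪ {S} {S′} NSy with N-elim NSy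
  ... | z , Sz∨S′z , Ezy =
    [ (λ Sz → inj₁ (N-intro {S} Sz Ezy)) , (λ S′z → inj₂ (N-intro {S′} S′z Ezy)) ] (to T-∨ Sz∨S′z)

  N-∅ : ∀ {y} → ¬ T (N ∅ y)
  N-∅ {y} = proj₁ ∘ proj₂ ∘ N-elim {∅} {y}

  N-singleton : ∀ {x y} → T (N (λ z → ⌊ x ≟ z ⌋) y) → E x y
  N-singleton NSy with N-elim NSy
  ... | z , x≡z , Ezy = subst (λ v → E v _) (sym (toWitness x≡z)) Ezy

  N-cong : ∀ {S S′} → (∀ z → S z ≡ S′ z) → ∀ y → N S y ≡ N S′ y
  N-cong S≗S′ y = cong or (map-cong (λ z → cong (_∧ ⌊ E? z y ⌋) (S≗S′ z)) L)

  mass : Family → (V → ℕ) → ℕ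
  mass S s = ∑ L (λ z → 𝟙 (S z) * s z)

  mass-mono : ∀ {S S′} s → (∀ {z} → T (S z) → T (S′ z)) → mass S s ≤ mass S′ s
  mass-mono s S⊆S′ = ∑-mono L (λ z → 𝟙*-mono (s z) S⊆S′)

  mass-cong : ∀ {S S′} s → (∀ z → S z ≡ S′ z) → mass S s ≡ mass S′ s
  mass-cong s S≗S′ = ∑-cong L (λ z → cong (λ b → 𝟙 b * s z) (S≗S′ z))

  mass-modular : ∀ S S′ s →
    mass (λ z → S z ∨ S′ z) s + mass (λ z → S z ∧ S′ z) s ≡ mass S s + mass S′ s
  mass-modular S S′ s =
    trans (sym (∑-distrib-+ L _ _)) (trans (∑-cong L (λ z → 𝟙-∨-∧ (S z) (S′ z) (s z))) (∑-distrib-+ L _ _))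

  mass-N-submodular : ∀ S S′ c →
    mass (N (λ z → S z ∨ S′ z)) c + mass (N (λ z → S z ∧ S′ z)) c ≤ mass (N S) c + mass (N S′) c
  mass-N-submodular S S′ c = subst₂ _≤_ (∑-distrib-+ L _ _) (∑-distrib-+ L _ _) (∑-mono L (λ y →
    𝟙-submodular (c y) N-∪ (λ t → N-mono (proj₁ ∘ to T-∧) t , N-mono (proj₂ ∘ to T-∧) t)))

  mass-+δ : ∀ S {s s′} x → (∀ z → s z ≡ s′ z + δ x z) → mass S s ≡ mass S s′ + 𝟙 (S x)
  mass-+δ S {s} {s′} x s≗s′+δ = begin
    mass S s                                      ≡⟨ ∑-cong L split ⟩
    ∑ L (λ z → 𝟙 (S z) * s′ z + 𝟙 (S z) * δ x z)  ≡⟨ ∑-distrib-+ L _ _ ⟩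
    mass S s′ + ∑ L (λ z → 𝟙 (S z) * δ x z)       ≡⟨ cong (mass S s′ +_) (∑-sift x (𝟙 ∘ S)) ⟩
    mass S s′ + 𝟙 (S x)                           ∎
    where
    open ≡-Reasoning
    split : ∀ z → 𝟙 (S z) * s z ≡ 𝟙 (S z) * s′ z + 𝟙 (S z) * δ x z
    split z = trans (cong (𝟙 (S z) *_) (s≗s′+δ z)) (*-distribˡ-+ (𝟙 (S z)) (s′ z) (δ x z))

  mass-insert : ∀ {S} s x → ¬ T (S x) → mass (λ z → S z ∨ ⌊ x ≟ z ⌋) s ≡ mass S s + s x
  mass-insert {S} s x x∉S = begin
    mass (λ z → S z ∨ ⌊ x ≟ z ⌋) s           ≡⟨ ∑-cong L split ⟩
    ∑ L (λ z → 𝟙 (S z) * s z + s z * δ x z) ≡⟨ ∑-distrib-+ L _ _ ⟩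
    mass S s + ∑ L (λ z → s z * δ x z)      ≡⟨ cong (mass S s +_) (∑-sift x s) ⟩
    mass S s + s x                          ∎
    where
    open ≡-Reasoning
    fresh : ∀ b → ¬ T b → 𝟙 (b ∨ true) * s x ≡ 𝟙 b * s x + s x * 1
    fresh false _ = *-comm 1 (s x)
    fresh true  ¬⊤ = ⊥-elim (¬⊤ _)
    split : ∀ z → 𝟙 (S z ∨ ⌊ x ≟ z ⌋) * s z ≡ 𝟙 (S z) * s z + s z * δ x z
    split z with x ≟ z
    ... | no _     = trans (cong (λ b → 𝟙 b * s z) (∨-identityʳ (S z)))
                           (sym (trans (cong (𝟙 (S z) * s z +_) (*-zeroʳ (s z))) (+-identityʳ _)))
    ... | yes refl = fresh (S x) x∉S

  HallCondition : (s c : V → ℕ) → Set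
  HallCondition s c = ∀ S → mass S s ≤ mass (N S) c

  Tight : (s c : V → ℕ) → Family → Set
  Tight s c S = mass (N S) c ≤ mass S s

  tight-∅ : ∀ s c → Tight s c ∅
  tight-∅ s c = ≤-trans (mass-mono {S′ = ∅} c λ {y} → N-∅ {y}) (≤-trans (≤-reflexive (∑-zero L)) z≤n)

  tight-∪ : ∀ {s c} → HallCondition s c →
            ∀ {S S′} → Tight s c S → Tight s c S′ → Tight s c (λ z → S z ∨ S′ z)
  tight-∪ {s} {c} hall {S} {S′} tight-S tight-S′ = +-cancelʳ-≤ (mass (N S∩S′) c) _ _ (begin
    mass (N S∪S′) c + mass (N S∩S′) c ≤⟨ mass-N-submodular S S′ c ⟩
    mass (N S) c + mass (N S′) c      ≤⟨ +-mono-≤ tight-S tight-S′ ⟩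
    mass S s + mass S′ s              ≡⟨ mass-modular S S′ s ⟨
    mass S∪S′ s + mass S∩S′ s         ≤⟨ +-monoʳ-≤ (mass S∪S′ s) (hall S∩S′) ⟩
    mass S∪S′ s + mass (N S∩S′) c     ∎)
    where
    open ≤-Reasoning
    S∪S′ S∩S′ : Family
    S∪S′ z = S z ∨ S′ z
    S∩S′ z = S z ∧ S′ z

  violation⇒tight : ∀ {s s′ c c′ x y S} → HallCondition s c →
    (∀ z → s z ≡ s′ z + δ x z) → (∀ z → c z ≡ c′ z + δ y z) → mass (N S) c′ < mass S s′ →
    ¬ T (S x) × T (N S y) × Tight s c S
  violation⇒tight {x = x} {y} {S} hall s≗ c≗ violated
    with one-unit-gap (S x) (N S y) (subst₂ _≤_ (mass-+δ S x s≗) (mass-+δ (N S) y c≗) (hall S)) violated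
  ... | x∉S , y∈NS , tight = x∉S , y∈NS , subst₂ _≤_ (sym (mass-+δ (N S) y c≗)) (sym (mass-+δ S x s≗)) tight

  update : V → Bool → Family → Family
  update x b S z = if ⌊ x ≟ z ⌋ then b else S z

  families : List V → List Family
  families []      = ∅ ∷ []
  families (x ∷ l) = cartesianProductWith (update x) (false ∷ true ∷ []) (families l)

  families-complete : ∀ l (S : Family) → ∃ λ S′ → S′ ∈ families l × (∀ {z} → z ∈ l → S′ z ≡ S z)
  families-complete []      S = ∅ , here refl , λ { {_} () }
  families-complete (x ∷ l) S with families-complete l S
  ... | S′ , S′∈ , S′≗S = update x (S x) S′ , ∈-cartesianProductWith⁺ (update x) (bool∈ (S x)) S′∈ , agree
    where
    bool∈ : ∀ b → b ∈ false ∷ true ∷ []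
    bool∈ false = here refl
    bool∈ true  = there (here refl)
    agree : ∀ {z} → z ∈ x ∷ l → update x (S x) S′ z ≡ S z
    agree {z} z∈ with x ≟ z | z∈
    ... | yes refl | _         = refl
    ... | no x≢z   | here refl = ⊥-elim (x≢z refl)
    ... | no _     | there z∈l = S′≗S z∈l

  hall? : ∀ s c → HallCondition s c ⊎ ∃ λ S → mass (N S) c < mass S s
  hall? s c with any? (λ S → mass (N S) c <? mass S s) (families L)
  ... | yes violated  = inj₂ (satisfied violated)
  ... | no ¬violated = inj₁ λ S → let (S′ , S′∈ , S′≗S) = families-complete L S in
    subst₂ _≤_ (mass-cong s (λ z → S′≗S (complete z))) (mass-cong c (N-cong (λ z → S′≗S (complete z))))
      (≮⇒≥ (¬violated ∘ lose S′∈))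

  record Transport (s c : V → ℕ) : Set where
    field
      plan         : V → V → ℕ
      plan-support : ∀ X Y → plan X Y ≢ 0 → E X Y
      row-sum      : ∀ X → ∑ L (plan X) ≡ s X
      column-sum   : ∀ Y → ∑ L (λ X → plan X Y) ≤ c Y

  zero-transport : ∀ {s c} → (∀ z → s z ≡ 0) → Transport s c
  zero-transport s≗0 = record
    { plan         = λ _ _ → 0
    ; plan-support = λ _ _ 0≢0 → ⊥-elim (0≢0 refl)
    ; row-sum      = λ X → trans (∑-zero L) (sym (s≗0 X))
    ; column-sum   = λ Y → ≤-trans (≤-reflexive (∑-zero L)) z≤n
    }

  δ*δ≡0⊎≡ : ∀ x X y Y → δ x X * δ y Y ≡ 0 ⊎ (x ≡ X × y ≡ Y)
  δ*δ≡0⊎≡ x X y Y with x ≟ X | y ≟ Y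
  ... | yes refl | yes refl = inj₂ (refl , refl)
  ... | yes _    | no _     = inj₁ refl
  ... | no _     | _        = inj₁ refl

  add-unit : ∀ {s c x y} → 0 < s x → 0 < c y → E x y →
             Transport (decrement s x) (decrement c y) → Transport s c
  add-unit {s} {c} {x} {y} sx>0 cy>0 Exy T′ = record
    { plan = plan′ ; plan-support = plan′-support ; row-sum = row-sum′ ; column-sum = column-sum′ }
    where
    open Transport T′
    plan′ : V → V → ℕ
    plan′ X Y = plan X Y + δ x X * δ y Y

    plan′-support : ∀ X Y → plan′ X Y ≢ 0 → E X Y
    plan′-support X Y plan′≢0 with δ*δ≡0⊎≡ x X y Y
    ... | inj₂ (refl , refl) = Exy
    ... | inj₁ δ*δ≡0         = plan-support X Y (λ plan≡0 → plan′≢0 (cong₂ _+_ plan≡0 δ*δ≡0))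

    row-sum′ : ∀ X → ∑ L (plan′ X) ≡ s X
    row-sum′ X = begin
      ∑ L (plan′ X)                                     ≡⟨ ∑-distrib-+ L _ _ ⟩
      ∑ L (plan X) + ∑ L (λ Y → δ x X * δ y Y)          ≡⟨ cong₂ _+_ (row-sum X) (∑-sift y (λ _ → δ x X)) ⟩
      decrement s x X + δ x X                           ≡⟨ decrement-+δ s sx>0 X ⟨
      s X                                               ∎
      where open ≡-Reasoning

    column-sum′ : ∀ Y → ∑ L (λ X → plan′ X Y) ≤ c Y
    column-sum′ Y = begin
      ∑ L (λ X → plan′ X Y)                             ≡⟨ ∑-distrib-+ L _ _ ⟩
      ∑ L (λ X → plan X Y) + ∑ L (λ X → δ x X * δ y Y)  ≡⟨ cong (∑ L (λ X → plan X Y) +_) unit-column ⟩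
      ∑ L (λ X → plan X Y) + δ y Y                      ≤⟨ +-monoˡ-≤ (δ y Y) (column-sum Y) ⟩
      decrement c y Y + δ y Y                           ≡⟨ decrement-+δ c cy>0 Y ⟨
      c Y                                               ∎
      where
      open ≤-Reasoning
      unit-column : ∑ L (λ X → δ x X * δ y Y) ≡ δ y Y
      unit-column = trans (∑-cong L (λ X → *-comm (δ x X) (δ y Y))) (∑-sift x (λ _ → δ y Y))

  module Augmentation {s c : V → ℕ} (hall : HallCondition s c) {x : V} (sx>0 : 0 < s x) where

    Augmenting : V → Set
    Augmenting y = E x y × 0 < c y × HallCondition (decrement s x) (decrement c y)

    Blocking : List V → Set
    Blocking l = ∃ λ B → ¬ T (B x) × Tight s c B × (∀ {y} → y ∈ l → E x y → 0 < c y → T (N B y))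

    search : ∀ l → (∃ λ y → Augmenting y) ⊎ Blocking l
    search []      = inj₂ (∅ , (λ ()) , tight-∅ s c , λ ())
    search (y ∷ l) with search l
    ... | inj₁ augmenting = inj₁ augmenting
    ... | inj₂ (B , x∉B , tight-B , B-covers) with E? x y ×-dec (0 <? c y)
    ...   | no ¬candidate = inj₂ (B , x∉B , tight-B , covers)
      where
      covers : ∀ {y′} → y′ ∈ y ∷ l → E x y′ → 0 < c y′ → T (N B y′)
      covers (here refl) Exy cy>0 = ⊥-elim (¬candidate (Exy , cy>0))
      covers (there y′∈l)        = B-covers y′∈l
    ...   | yes (Exy , cy>0) with hall? (decrement s x) (decrement c y)
    ...     | inj₁ hall′ = inj₁ (y , Exy , cy>0 , hall′)
    ...     | inj₂ (S , violated)
      with violation⇒tight hall (decrement-+δ s sx>0) (decrement-+δ c cy>0) violated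
    ...       | x∉S , y∈NS , tight-S =
      inj₂ ((λ z → B z ∨ S z) , x∉B∪S , tight-∪ hall tight-B tight-S , covers)
      where
      x∉B∪S : ¬ T (B x ∨ S x)
      x∉B∪S = [ x∉B , x∉S ] ∘ to T-∨
      covers : ∀ {y′} → y′ ∈ y ∷ l → E x y′ → 0 < c y′ → T (N (λ z → B z ∨ S z) y′)
      covers (here refl)  _     _      = N-mono (from T-∨ ∘ inj₂) y∈NS
      covers (there y′∈l) Exy′ cy′>0 = N-mono (from T-∨ ∘ inj₁) (B-covers y′∈l Exy′ cy′>0)

    no-blocking : ¬ Blocking L
    no-blocking (B , x∉B , tight-B , B-covers) = <⇒≱ sx>0 (+-cancelˡ-≤ (mass B s) _ _ (begin
      mass B s + s x      ≡⟨ mass-insert {B} s x x∉B ⟨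
      mass B+x s          ≤⟨ hall B+x ⟩
      mass (N B+x) c      ≤⟨ ∑-mono L N-B+x≤N-B ⟩
      mass (N B) c        ≤⟨ tight-B ⟩
      mass B s            ≡⟨ +-identityʳ (mass B s) ⟨
      mass B s + 0        ∎))
      where
      open ≤-Reasoning
      B+x : Family
      B+x z = B z ∨ ⌊ x ≟ z ⌋
      N-B+x≤N-B : ∀ y → 𝟙 (N B+x y) * c y ≤ 𝟙 (N B y) * c y
      N-B+x≤N-B y = 𝟙*-mono′ {N B+x y} {N B y} (c y) λ cy>0 NB+x →
        [ id , (λ Nx → B-covers (complete y) (N-singleton Nx) cy>0) ] (N-∪ {B} NB+x)

  transport-with-supply : ∀ k {s c} → ∑ L s ≡ k → HallCondition s c → Transport s c
  transport-with-supply k {s} {c} ∑s≡k hall with any? (λ z → 0 <? s z) L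
  ... | no ¬positive = zero-transport (λ z → n≤0⇒n≡0 (≮⇒≥ (¬positive ∘ lose (complete z))))
  ... | yes positive with satisfied positive
  ...   | x , sx>0 with Augmentation.search hall sx>0 L
  ...     | inj₂ blocking = ⊥-elim (Augmentation.no-blocking hall sx>0 blocking)
  ...     | inj₁ (y , Exy , cy>0 , hall′) with k | trans (sym ∑s≡k) (∑-decrement s sx>0)
  ...       | suc k′ | k≡1+∑ =
    add-unit sx>0 cy>0 Exy (transport-with-supply k′ (sym (suc-injective k≡1+∑)) hall′)

  transport : ∀ {s c} → HallCondition s c → Transport s c
  transport = transport-with-supply _ refl

-- Harris's inequality

-- Writing a₀ = a₁ + u and b₀ = b₁ + v, the two sides differ by u * v.
chebyshev : ∀ {a₀ a₁ b₀ b₁} → a₁ ≤ a₀ → b₁ ≤ b₀ → (a₀ + a₁) * (b₀ + b₁) ≤ 2 * (a₀ * b₀ + a₁ * b₁)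
chebyshev {a₁ = a} {b₁ = b} a≤a₀ b≤b₀ with m≤n⇒∃[o]m+o≡n a≤a₀ | m≤n⇒∃[o]m+o≡n b≤b₀
... | u , refl | v , refl = ≤-trans (m≤m+n _ (u * v)) (≤-reflexive (identity a u b v))
  where
  identity : ∀ a u b v → ((a + u) + a) * ((b + v) + b) + u * v ≡ 2 * ((a + u) * (b + v) + a * b)
  identity = solve-∀

chebyshev-anti : ∀ {a₀ a₁ b₀ b₁} → a₁ ≤ a₀ → b₁ ≤ b₀ → 2 * (a₁ * b₀ + a₀ * b₁) ≤ (a₀ + a₁) * (b₀ + b₁)
chebyshev-anti {a₁ = a} {b₁ = b} a≤a₀ b≤b₀ with m≤n⇒∃[o]m+o≡n a≤a₀ | m≤n⇒∃[o]m+o≡n b≤b₀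
... | u , refl | v , refl = ≤-trans (m≤m+n _ (u * v)) (≤-reflexive (identity a u b v))
  where
  identity : ∀ a u b v → 2 * (a * (b + v) + (a + u) * b) + u * v ≡ ((a + u) + a) * ((b + v) + b)
  identity = solve-∀

2^n-doubling : ∀ n a b → 2 * (2 ^ n * a + 2 ^ n * b) ≡ 2 ^ suc n * (a + b)
2^n-doubling n a b = trans (cong (2 *_) (sym (*-distribˡ-+ (2 ^ n) a b))) (sym (*-assoc 2 (2 ^ n) (a + b)))

Σ⊆-suc : ∀ n (h : Subset (suc n) → ℕ) → Σ⊆ (suc n) h ≡ Σ⊆ n (h ∘ (outside ∷_)) + Σ⊆ n (h ∘ (inside ∷_))
Σ⊆-suc n h = trans (∑-++ (map (outside ∷_) (allSubsets n)) _ h)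
                   (cong₂ _+_ (cong sum (sym (map-∘ (allSubsets n)))) (cong sum (sym (map-∘ (allSubsets n)))))

Monotone-∷ : ∀ {n} {f : Subset (suc n) → ℕ} b → Monotone f → Monotone (f ∘ (b ∷_))
Monotone-∷ outside mf A i = mf (outside ∷ A) (suc i)
Monotone-∷ inside  mf A i = mf (inside ∷ A) (suc i)

Σ⊆-inside≤outside : ∀ {n} {f : Subset (suc n) → ℕ} → Monotone f →
                    Σ⊆ n (f ∘ (inside ∷_)) ≤ Σ⊆ n (f ∘ (outside ∷_))
Σ⊆-inside≤outside {n} {f} mf = ∑-mono (allSubsets n) inside≤outside
  where
  inside≤outside : ∀ X → f (inside ∷ X) ≤ f (outside ∷ X)
  inside≤outside X = subst (λ Y → f (inside ∷ X) ≤ f (outside ∷ Y)) (p─⊥≡p X) (mf (inside ∷ X) zero)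

harris-zero : (f g : Subset 0 → ℕ) → Σ⊆ 0 f * Σ⊆ 0 g ≡ 2 ^ 0 * Σ⊆ 0 (λ X → f X * g X)
harris-zero f g = identity (f []) (g [])
  where
  identity : ∀ a b → (a + 0) * (b + 0) ≡ 1 * (a * b + 0)
  identity = solve-∀

harris : ∀ n {f g : Subset n → ℕ} → Monotone f → Monotone g →
         Σ⊆ n f * Σ⊆ n g ≤ 2 ^ n * Σ⊆ n (λ X → f X * g X)
harris zero    {f} {g} _  _  = ≤-reflexive (harris-zero f g)
harris (suc n) {f} {g} mf mg = begin
  Σ⊆ (suc n) f * Σ⊆ (suc n) g                     ≡⟨ cong₂ _*_ (Σ⊆-suc n f) (Σ⊆-suc n g) ⟩
  (F₀ + F₁) * (G₀ + G₁)                           ≤⟨ chebyshev (Σ⊆-inside≤outside mf) (Σ⊆-inside≤outside mg) ⟩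
  2 * (F₀ * G₀ + F₁ * G₁)                         ≤⟨ *-monoʳ-≤ 2 (+-mono-≤ outside-half inside-half) ⟩
  2 * (2 ^ n * P₀ + 2 ^ n * P₁)                   ≡⟨ 2^n-doubling n P₀ P₁ ⟩
  2 ^ suc n * (P₀ + P₁)                           ≡⟨ cong (2 ^ suc n *_) (Σ⊆-suc n (λ X → f X * g X)) ⟨
  2 ^ suc n * Σ⊆ (suc n) (λ X → f X * g X)        ∎
  where
  open ≤-Reasoning
  F₀ F₁ G₀ G₁ P₀ P₁ : ℕ
  F₀ = Σ⊆ n (f ∘ (outside ∷_))
  F₁ = Σ⊆ n (f ∘ (inside ∷_))
  G₀ = Σ⊆ n (g ∘ (outside ∷_))
  G₁ = Σ⊆ n (g ∘ (inside ∷_))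
  P₀ = Σ⊆ n (λ X → f (outside ∷ X) * g (outside ∷ X))
  P₁ = Σ⊆ n (λ X → f (inside ∷ X) * g (inside ∷ X))
  outside-half : F₀ * G₀ ≤ 2 ^ n * P₀
  outside-half = harris n (Monotone-∷ outside mf) (Monotone-∷ outside mg)
  inside-half : F₁ * G₁ ≤ 2 ^ n * P₁
  inside-half = harris n (Monotone-∷ inside mf) (Monotone-∷ inside mg)

harris-∁ : ∀ n {f g : Subset n → ℕ} → Monotone f → Monotone g →
           2 ^ n * Σ⊆ n (λ X → f (∁ X) * g X) ≤ Σ⊆ n f * Σ⊆ n g
harris-∁ zero    {f} {g} _  _  = ≤-reflexive (sym (harris-zero f g))
harris-∁ (suc n) {f} {g} mf mg = begin
  2 ^ suc n * Σ⊆ (suc n) (λ X → f (∁ X) * g X)    ≡⟨ cong (2 ^ suc n *_) (Σ⊆-suc n (λ X → f (∁ X) * g X)) ⟩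
  2 ^ suc n * (P₀ + P₁)                           ≡⟨ 2^n-doubling n P₀ P₁ ⟨
  2 * (2 ^ n * P₀ + 2 ^ n * P₁)                   ≤⟨ *-monoʳ-≤ 2 (+-mono-≤ outside-half inside-half) ⟩
  2 * (F₁ * G₀ + F₀ * G₁)                         ≤⟨ chebyshev-anti (Σ⊆-inside≤outside mf) (Σ⊆-inside≤outside mg) ⟩
  (F₀ + F₁) * (G₀ + G₁)                           ≡⟨ cong₂ _*_ (Σ⊆-suc n f) (Σ⊆-suc n g) ⟨
  Σ⊆ (suc n) f * Σ⊆ (suc n) g                     ∎
  where
  open ≤-Reasoning
  F₀ F₁ G₀ G₁ P₀ P₁ : ℕ
  F₀ = Σ⊆ n (f ∘ (outside ∷_))
  F₁ = Σ⊆ n (f ∘ (inside ∷_))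
  G₀ = Σ⊆ n (g ∘ (outside ∷_))
  G₁ = Σ⊆ n (g ∘ (inside ∷_))
  P₀ = Σ⊆ n (λ X → f (inside ∷ ∁ X) * g (outside ∷ X))
  P₁ = Σ⊆ n (λ X → f (outside ∷ ∁ X) * g (inside ∷ X))
  outside-half : 2 ^ n * P₀ ≤ F₁ * G₀
  outside-half = harris-∁ n (Monotone-∷ inside mf) (Monotone-∷ outside mg)
  inside-half : 2 ^ n * P₁ ≤ F₀ * G₁
  inside-half = harris-∁ n (Monotone-∷ outside mf) (Monotone-∷ inside mg)

-- Plans supported on disjoint pairs

allSubsets-complete : ∀ n (X : Subset n) → X ∈ allSubsets n
allSubsets-complete zero    []            = here refl
allSubsets-complete (suc n) (outside ∷ X) = ∈-++⁺ˡ (∈-map⁺ (outside ∷_) (allSubsets-complete n X))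
allSubsets-complete (suc n) (inside ∷ X)  = ∈-++⁺ʳ _ (∈-map⁺ (inside ∷_) (allSubsets-complete n X))

allSubsets-unique : ∀ n → Unique (allSubsets n)
allSubsets-unique zero    = [] ∷ []
allSubsets-unique (suc n) =
  ++⁺ (map⁺ ∷-injectiveʳ (allSubsets-unique n)) (map⁺ ∷-injectiveʳ (allSubsets-unique n)) heads-differ
  where
  heads-differ : ∀ {X} → ¬ (X ∈ map (outside ∷_) (allSubsets n) × X ∈ map (inside ∷_) (allSubsets n))
  heads-differ (X∈₀ , X∈₁) with ∈-map⁻ (outside ∷_) X∈₀ | ∈-map⁻ (inside ∷_) X∈₁
  ... | _ , _ , refl | _ , _ , ()

Disjoint-⊆ : ∀ {n} {X Y Z : Subset n} → Disjoint X Y → Z ⊆ Y → Disjoint X Z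
Disjoint-⊆ {X = X} {Y} {Z} X∩Y≡⊥ Z⊆Y = ⊆-antisym X∩Z⊆⊥ ⊥⊆
  where
  X∩Z⊆⊥ : X ∩ Z ⊆ ⊥
  X∩Z⊆⊥ x∈X∩Z with x∈p∩q⁻ X Z x∈X∩Z
  ... | x∈X , x∈Z = subst (_ ∈ₛ_) X∩Y≡⊥ (x∈p∩q⁺ (x∈X , Z⊆Y x∈Z))

disjoint? : ∀ {n} → Decidable (Disjoint {n})
disjoint? X Y = ≡-dec _≟ᵇ_ (X ∩ Y) ⊥

module DisjointnessTransport (n : ℕ) =
  Transportation (≡-dec _≟ᵇ_) (allSubsets n) (allSubsets-complete n) (allSubsets-unique n) Disjoint disjoint?

disjointness-hall : ∀ n {f g : Subset n → ℕ} → Monotone f → Monotone g → ∣ f ∣ₛ ≤ ∣ g ∣ₛ →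
                    DisjointnessTransport.HallCondition n f g
disjointness-hall n {f} {g} mf mg |f|≤|g| S = *-cancelˡ-≤ (2 ^ n) {{m^n≢0 2 n}} (begin
  2 ^ n * mass S f                           ≤⟨ *-monoʳ-≤ (2 ^ n) (∑-mono (allSubsets n) S≤N∁) ⟩
  2 ^ n * Σ⊆ n (λ X → 𝟙 (N S (∁ X)) * f X)    ≤⟨ harris-∁ n N-monotone mf ⟩
  Σ⊆ n (𝟙 ∘ N S) * Σ⊆ n f                    ≤⟨ *-monoʳ-≤ (Σ⊆ n (𝟙 ∘ N S)) |f|≤|g| ⟩
  Σ⊆ n (𝟙 ∘ N S) * Σ⊆ n g                    ≤⟨ harris n N-monotone mg ⟩
  2 ^ n * mass (N S) g                       ∎)
  where
  open DisjointnessTransport n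
  open ≤-Reasoning
  S≤N∁ : ∀ X → 𝟙 (S X) * f X ≤ 𝟙 (N S (∁ X)) * f X
  S≤N∁ X = 𝟙*-mono {S X} {N S (∁ X)} (f X) λ SX → N-intro {S} SX (∩-inverseʳ X)
  N-monotone : Monotone (𝟙 ∘ N S)
  N-monotone A i = 𝟙-mono λ NSA →
    let (X , SX , X∩A≡⊥) = N-elim NSA in N-intro SX (Disjoint-⊆ X∩A≡⊥ (p─q⊆p A _))

theorem11 : (n : ℕ) → n ≥ 1 → (f g : Subset n → ℕ) → Monotone f → Monotone g → ∣ f ∣ₛ ≤ ∣ g ∣ₛ →
    Σ (Subset n → Subset n → ℕ) λ p →
      ((X Y : Subset n) → p X Y ≢ 0 → Disjoint X Y)
      × (∣ p ∣₂ ≡ ∣ f ∣ₛ)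
      × ((Y : Subset n) → Σ⊆ n (λ X → p X Y) ≤ g Y)
      × ((X : Subset n) → Σ⊆ n (λ Y → p X Y) ≡ f X)
theorem11 n _ f g mf mg |f|≤|g| = plan , plan-support , ∑-cong (allSubsets n) row-sum , column-sum , row-sum
  where
  open DisjointnessTransport n
  open Transport (transport (disjointness-hall n mf mg |f|≤|g|))
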